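{- Let $m,n,s,k$ be even integers such that $2\leqslant s\leqslant n$, $2\leqslant k\leqslant m$ and $ms=nk$, and let $c\geqslant 1$. For every abelian group $\Gamma$ of order $nkc$ there exists an $\mathrm{MRS}_\Gamma(m,n;s,k;c)$.
   Context: For positive integers $m,n,s,k,c$ and an abelian group $\Gamma$ of order $nkc$, an $\mathrm{MRS}_\Gamma(m,n;s,k;c)$ is a set of $c$ partially filled $m\times n$ arrays (some cells may be empty) with entries in $\Gamma$ such that: every element of $\Gamma$ appears exactly once and in a unique array; in every array each row has exactly $s$ filled cells and each column exactly $k$ filled cells; and there exist (not necessarily distinct) $\omega,\delta\in\Gamma$ such that in every array each row sums to $\omega$ and each column sums to $\delta$. -}

module Defs where

open import Level using (Level)
open import Data.Nat using (ℕ; zero; suc; _+_; _*_)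
open import Data.Fin using (Fin)
open import Data.Maybe using (Maybe; just; nothing; fromMaybe)
open import Data.Product using (Σ; _×_; _,_; ∃)
open import Relation.Binary.PropositionalEquality using (_≡_; setoid)
open import Algebra.Bundles using (AbelianGroup)
open import Function.Bundles using (Bijection)

countJust : ∀ {a} {A : Set a} {n : ℕ} → (Fin n → Maybe A) → ℕ
countJust {n = zero}  f = 0
countJust {n = suc n} f with f Fin.zero
... | just _  = suc (countJust (λ j → f (Fin.suc j)))
... | nothing = countJust (λ j → f (Fin.suc j))

HasOrder : ∀ {a ℓ} → AbelianGroup a ℓ → ℕ → Set (a Level.⊔ ℓ)
HasOrder G N = Bijection (setoid (Fin N)) (AbelianGroup.setoid G)

module _ {a ℓ} (G : AbelianGroup a ℓ) where
  open AbelianGroup G renaming (Carrier to Γ)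

  lineSum : ∀ {n} → (Fin n → Maybe Γ) → Γ
  lineSum {zero}  f = ε
  lineSum {suc n} f = fromMaybe ε (f Fin.zero) ∙ lineSum (λ j → f (Fin.suc j))

  -- a family of c partially filled m×n arrays over Γ: cell (t,i,j) is
  -- either empty (nothing) or filled with an element (just x)
  Arrays : ℕ → ℕ → ℕ → Set a
  Arrays m n c = Fin c → Fin m → Fin n → Maybe Γ

  record IsMRS (m n s k c : ℕ) (A : Arrays m n c) : Set (a Level.⊔ ℓ) where
    field
      appears : ∀ (g : Γ) → Σ (Fin c × Fin m × Fin n) λ { (t , i , j) →
                  Σ Γ λ x → (A t i j ≡ just x) × (x ≈ g) }
      unique  : ∀ (g : Γ) (t t′ : Fin c) (i i′ : Fin m) (j j′ : Fin n) (x x′ : Γ) →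
                  A t i j ≡ just x → x ≈ g → A t′ i′ j′ ≡ just x′ → x′ ≈ g →
                  (t , i , j) ≡ (t′ , i′ , j′)
      rowCount : ∀ t i → countJust (λ j → A t i j) ≡ s
      colCount : ∀ t j → countJust (λ i → A t i j) ≡ k
      ω δ     : Γ
      rowSum  : ∀ t i → lineSum (λ j → A t i j) ≈ ω
      colSum  : ∀ t j → lineSum (λ i → A t i j) ≈ δ

  MRS : (m n s k c : ℕ) → Set (a Level.⊔ ℓ)
  MRS m n s k c = Σ (Arrays m n c) (IsMRS m n s k c)

{-# OPTIONS --safe #-}

-- Γ has an involution u since |Γ| is even, and since 4 divides |Γ| there is a σ such that neither σ nor
-- σ u is a square. The reflections y ↦ σ y⁻¹ and y ↦ σ u y⁻¹ then generate a Klein four-group acting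
-- freely on Γ, and each of its |Γ| / 4 orbits, written as the block [[y , σ y⁻¹] , [σ u y⁻¹ , y u]], has
-- row sums σ and column sums σ u. These c (m/2) (s/2) blocks are laid out in c arrays of (m/2) × (n/2)
-- blocks, block r of block row i going to block column (i s/2 + r) mod n/2, which puts s/2 blocks in
-- each block row and k/2 in each block column.

module Submission where

open import Defs
open import Level using (Level; _⊔_)
open import Data.Nat using (ℕ; _*_; _≤_)
open import Data.Nat.Divisibility using (_∣_)
open import Relation.Binary.PropositionalEquality using (_≡_)
open import Algebra.Bundles using (AbelianGroup)

open import Data.Bool.Base using (Bool; true; false; T; if_then_else_)
open import Data.Bool.Properties using (T-irrelevant)
open import Data.Empty using (⊥-elim)
open import Data.Fin.Base using (Fin; zero; suc; toℕ; cast; combine; remQuot)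
import Data.Fin.Base as Fin
open import Data.Fin.Permutation using (↔⇒≡)
open import Data.Fin.Properties
  using (_≟_; any?; ¬∀⟶∃¬; injective⇒≤; ≤-antisym; ≤-totalOrder; nonZeroIndex; 0↔⊥; 1↔⊤; +↔⊎; *↔×;
         toℕ<n; toℕ-injective; toℕ-cast; toℕ-combine; cast-involutive; combine-remQuot; remQuot-combine)
open import Data.List.Base using (List)
import Data.List.Base as List
import Data.List.Extrema
open import Data.List.Membership.Propositional using (_∈_)
open import Data.List.Membership.Propositional.Properties using (∈-map⁺; ∈-allFin)
open import Data.List.Relation.Unary.All using (lookup)
open import Data.Maybe.Base using (Maybe; just; nothing; is-just; fromMaybe)
import Data.Maybe.Base as Maybe
open import Data.Nat.Base using (zero; suc; _+_; _<_; NonZero; z≤n; s≤s; >-nonZero)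
open import Data.Nat.Divisibility using (divides; ∣-trans; ∣m+n∣m⇒∣n; n∣m*n; ∣⇒≤)
open import Data.Nat.Properties
  using (<⇒≱; <-cmp; <-irrefl; <-≤-trans; +-comm; +-assoc; *-suc; +-cancelˡ-≡; +-monoʳ-<; +-monoˡ-≤; m≤m+n;
         *-monoʳ-≤; *-monoʳ-<; m<m*n; m*n≢0⇒m≢0; *-cancelʳ-≡; *-cancelʳ-≤; module ≤-Reasoning)
open import Data.Nat.Tactic.RingSolver using (solve-∀)
open import Data.Product.Algebra using (×-cong)
open import Data.Product.Base using (Σ; ∃; ∃₂; _×_; _,_; proj₁; proj₂; uncurry)
open import Data.Product.Properties using (×-≡,≡→≡; ,-injective)
open import Data.Sum.Algebra using (⊎-cong)
open import Data.Sum.Base using (_⊎_; inj₁; inj₂)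
open import Data.Sum.Properties using (inj₂-injective)
open import Data.Unit using (tt)
open import Function.Base using (_∘_)
open import Function.Bundles using (Bijection; Inverse; _↔_; _⤖_; mk⤖; mk↔ₛ′)
open import Function.Definitions using (Injective)
open import Function.Properties.Bijection using (⤖⇒↔)
open import Function.Properties.Inverse using (↔-refl; ↔-sym; ↔-trans)
open import Relation.Binary.Bundles using (Setoid)
open import Relation.Binary.Definitions using (Decidable; tri<; tri≈; tri>)
import Relation.Binary.PropositionalEquality as ≡
open import Relation.Binary.PropositionalEquality using (refl)
import Relation.Binary.Reasoning.Setoid as SetoidReasoning
open import Relation.Nullary.Decidable
  using (Dec; yes; no; map′; ¬?; _×-dec_; ⌊_⌋; toWitness; fromWitness; dec⇒maybe)
open import Relation.Nullary.Negation using (¬_; contradiction)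

-- Counting subsets of Fin n

count : ∀ {n} → (Fin n → Bool) → ℕ
count {zero}  p = 0
count {suc n} p = if p zero then suc (count (p ∘ suc)) else count (p ∘ suc)

Subset : ∀ {n} → (Fin n → Bool) → Set
Subset {n} p = Σ (Fin n) (T ∘ p)

Subset-≡ : ∀ {n} {p : Fin n → Bool} {x y : Subset p} → proj₁ x ≡ proj₁ y → x ≡ y
Subset-≡ {x = i , s} {y = .i , t} refl = ≡.cong (i ,_) (T-irrelevant s t)

Subset-suc : ∀ {n} (p : Fin (suc n) → Bool) → Subset p ↔ (T (p zero) ⊎ Subset (p ∘ suc))
Subset-suc p = mk↔ₛ′ to from to∘from from∘to
  where
  to : Subset p → T (p zero) ⊎ Subset (p ∘ suc)
  to (zero  , t) = inj₁ t
  to (suc i , t) = inj₂ (i , t)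
  from : T (p zero) ⊎ Subset (p ∘ suc) → Subset p
  from (inj₁ t)       = zero , t
  from (inj₂ (i , t)) = suc i , t
  to∘from : ∀ x → to (from x) ≡ x
  to∘from (inj₁ t)       = refl
  to∘from (inj₂ (i , t)) = refl
  from∘to : ∀ x → from (to x) ≡ x
  from∘to (zero  , t) = refl
  from∘to (suc i , t) = refl

Subset↔count : ∀ {n} (p : Fin n → Bool) → Subset p ↔ Fin (count p)
Subset↔count {zero}  p = mk↔ₛ′ (λ ()) (λ ()) (λ ()) (λ { (() , _) })
Subset↔count {suc n} p = ↔-trans (Subset-suc p) (head (p zero))
  where
  head : (b : Bool) → (T b ⊎ Subset (p ∘ suc)) ↔ Fin (if b then suc (count (p ∘ suc)) else count (p ∘ suc))
  head true  = ↔-trans (⊎-cong (↔-sym 1↔⊤) (Subset↔count (p ∘ suc))) (↔-sym +↔⊎)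
  head false = ↔-trans (⊎-cong (↔-sym 0↔⊥) (Subset↔count (p ∘ suc))) (↔-sym +↔⊎)

countJust≡count : ∀ {a} {A : Set a} {n} (f : Fin n → Maybe A) → countJust f ≡ count (is-just ∘ f)
countJust≡count {n = zero}  f = refl
countJust≡count {n = suc n} f with f zero
... | just _  = ≡.cong suc (countJust≡count (f ∘ suc))
... | nothing = countJust≡count (f ∘ suc)

count-pairs : ∀ {n} (p : Fin (n * 2) → Bool) (q : Fin n → Bool) →
              (∀ i j → p (combine i j) ≡ q i) → count p ≡ count q * 2
count-pairs {zero}  p q eq = refl
count-pairs {suc n} p q eq rewrite eq zero zero | eq zero (suc zero) with q zero
... | true  = ≡.cong (λ m → suc (suc m)) (count-pairs (λ i → p (suc (suc i))) (λ i → q (suc i)) (λ i → eq (suc i)))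
... | false = count-pairs (λ i → p (suc (suc i))) (λ i → q (suc i)) (λ i → eq (suc i))

no-wrap : ∀ {n a r r′ l l′ c} → r′ < n → n * l + c ≡ a + r → n * l′ + c ≡ a + r′ → ¬ l < l′
no-wrap {n} {a} {r} {r′} {l} {l′} {c} r′<n eq eq′ l<l′ = <-irrefl refl (begin-strict
  a + r′            <⟨ +-monoʳ-< a r′<n ⟩
  a + n             ≤⟨ +-monoˡ-≤ n (m≤m+n a r) ⟩
  a + r + n         ≡⟨ ≡.cong (_+ n) eq ⟨
  n * l + c + n     ≡⟨ +-comm (n * l + c) n ⟩
  n + (n * l + c)   ≡⟨ +-assoc n (n * l) c ⟨
  n + n * l + c     ≡⟨ ≡.cong (_+ c) (*-suc n l) ⟨
  n * suc l + c     ≤⟨ +-monoˡ-≤ c (*-monoʳ-≤ n l<l′) ⟩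
  n * l′ + c        ≡⟨ eq′ ⟩
  a + r′            ∎)
  where open ≤-Reasoning

residue-window : ∀ {n a r r′ l l′ c} → r < n → r′ < n → n * l + c ≡ a + r → n * l′ + c ≡ a + r′ → r ≡ r′
residue-window {a = a} {r} {r′} {l} {l′} r<n r′<n eq eq′ with <-cmp l l′
... | tri< l<l′ _ _ = ⊥-elim (no-wrap r′<n eq eq′ l<l′)
... | tri> _ _ l>l′ = ⊥-elim (no-wrap r<n eq′ eq l>l′)
... | tri≈ _ refl _ = +-cancelˡ-≡ a r r′ (≡.trans (≡.sym eq) eq′)

∤m+k*n : ∀ {m n} k → 0 < m → m < n → ¬ n ∣ m + k * n
∤m+k*n {m} {n} k 0<m m<n n∣m+kn = <⇒≱ m<n (∣⇒≤ ⦃ >-nonZero 0<m ⦄ n∣m)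
  where
  n∣m : n ∣ m
  n∣m = ∣m+n∣m⇒∣n (≡.subst (n ∣_) (+-comm m (k * n)) n∣m+kn) (n∣m*n k)

-- Orbits of finite group actions

module FiniteSetoid {c ℓ} {X : Setoid c ℓ} {N : ℕ} (enumeration : Bijection (≡.setoid (Fin N)) X) where
  open Setoid X
  open Bijection enumeration using (to; injective; strictlySurjective)

  index : Carrier → Fin N
  index x = proj₁ (strictlySurjective x)

  to-index : ∀ x → to (index x) ≈ x
  to-index x = proj₂ (strictlySurjective x)

  index-cong : ∀ {x y} → x ≈ y → index x ≡ index y
  index-cong {x} {y} x≈y = injective (trans (to-index x) (trans x≈y (sym (to-index y))))

  index-injective : ∀ {x y} → index x ≡ index y → x ≈ y
  index-injective {x} {y} eq = trans (sym (to-index x)) (trans (reflexive (≡.cong to eq)) (to-index y))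

  index-to : ∀ i → index (to i) ≡ i
  index-to i = injective (to-index (to i))

  infix 4 _≈?_
  _≈?_ : Decidable _≈_
  x ≈? y = map′ index-injective index-cong (index x ≟ index y)

  search : ∀ {p} (P : Carrier → Set p) → (∀ {x y} → x ≈ y → P x → P y) → (∀ x → Dec (P x)) → Dec (∃ P)
  search P resp P? = map′ (λ (i , Pi) → to i , Pi)
                          (λ (x , Px) → index x , resp (sym (to-index x)) Px)
                          (any? (P? ∘ to))

  missed-point : ∀ {A : Set} {m} → Fin m ↔ A → (f : A → Carrier) → m < N → ∃ λ y → ∀ a → ¬ f a ≈ y
  missed-point {m = m} A-elements f m<N =
    let j , j-missed = ¬∀⟶∃¬ N (λ j → ∃ λ i → f′ i ≈ to j) (λ j → any? (λ i → f′ i ≈? to j)) not-surjective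
    in  to j , λ a fa≈j → j-missed (Inverse.from A-elements a ,
                                    trans (reflexive (≡.cong f (Inverse.strictlyInverseˡ A-elements a))) fa≈j)
    where
    f′ : Fin m → Carrier
    f′ = f ∘ Inverse.to A-elements
    not-surjective : ¬ (∀ j → ∃ λ i → f′ i ≈ to j)
    not-surjective hit = <⇒≱ m<N (injective⇒≤ section-injective)
      where
      section-injective : Injective _≡_ _≡_ (λ j → proj₁ (hit j))
      section-injective {j} {j′} eq =
        injective (trans (sym (proj₂ (hit j))) (trans (reflexive (≡.cong f′ eq)) (proj₂ (hit j′))))

record Action (H : Set) {c ℓ} (X : Setoid c ℓ) : Set (c ⊔ ℓ) where
  open Setoid X
  field
    e            : H
    _·_          : H → H → H
    inverse      : H → H
    inverseˡ     : ∀ g → inverse g · g ≡ e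
    act          : H → Carrier → Carrier
    act-cong     : ∀ g {x y} → x ≈ y → act g x ≈ act g y
    act-identity : ∀ x → act e x ≈ x
    act-compose  : ∀ g g′ x → act g (act g′ x) ≈ act (g · g′) x

  IsFreeAt : Carrier → Set ℓ
  IsFreeAt x = ∀ g g′ → act g x ≈ act g′ x → g ≡ g′

module Orbits {c ℓ} {X : Setoid c ℓ} {N : ℕ} (enumeration : Bijection (≡.setoid (Fin N)) X)
              {H : Set} {h : ℕ} (elements : Fin h ↔ H) (A : Action H X) where
  open Setoid X renaming (refl to ≈-refl)
  open Action A
  open FiniteSetoid enumeration
  open Bijection enumeration using (to)
  open Data.List.Extrema (≤-totalOrder N) using (argmin; f[argmin]≤f[xs])
  open SetoidReasoning X

  elementList : List H
  elementList = List.map (Inverse.to elements) (List.allFin h)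

  ∈-elementList : ∀ g → g ∈ elementList
  ∈-elementList g = ≡.subst (_∈ elementList) (Inverse.strictlyInverseˡ elements g)
                      (∈-map⁺ (Inverse.to elements) (∈-allFin (Inverse.from elements g)))

  _∼_ : Carrier → Carrier → Set ℓ
  x ∼ y = ∃ λ g → act g x ≈ y

  ≈⇒∼ : ∀ {x y} → x ≈ y → x ∼ y
  ≈⇒∼ x≈y = e , trans (act-identity _) x≈y

  ∼-sym : ∀ {x y} → x ∼ y → y ∼ x
  ∼-sym {x} {y} (g , gx≈y) = inverse g , (begin
    act (inverse g) y         ≈⟨ act-cong (inverse g) (sym gx≈y) ⟩
    act (inverse g) (act g x) ≈⟨ act-compose (inverse g) g x ⟩
    act (inverse g · g) x     ≡⟨ ≡.cong (λ g′ → act g′ x) (inverseˡ g) ⟩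
    act e x                   ≈⟨ act-identity x ⟩
    x                         ∎)

  ∼-trans : ∀ {x y z} → x ∼ y → y ∼ z → x ∼ z
  ∼-trans {x} (g , gx≈y) (g′ , g′y≈z) =
    g′ · g , trans (sym (act-compose g′ g x)) (trans (act-cong g′ gx≈y) g′y≈z)

  to-least : Carrier → H
  to-least x = argmin (λ g → index (act g x)) e elementList

  least : Carrier → Carrier
  least x = act (to-least x) x

  ∼least : ∀ x → x ∼ least x
  ∼least x = to-least x , ≈-refl

  least-≤ : ∀ {x y} → x ∼ y → index (least x) Fin.≤ index y
  least-≤ {x} (g , gx≈y) = ≡.subst (index (least x) Fin.≤_) (index-cong gx≈y)
    (lookup (f[argmin]≤f[xs] {f = λ g → index (act g x)} e elementList) (∈-elementList g))

  ∼⇒least≈ : ∀ {x y} → x ∼ y → least x ≈ least y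
  ∼⇒least≈ x∼y = index-injective (≤-antisym
    (least-≤ (∼-trans x∼y (∼least _)))
    (least-≤ (∼-trans (∼-sym x∼y) (∼least _))))

  module Decomposition
    {k : ℕ} (exceptional : Fin k → Carrier)
    (exceptional-injective : ∀ {i j} → exceptional i ≈ exceptional j → i ≡ j)
    (exceptional-closed : ∀ g i → ∃ λ j → act g (exceptional i) ≈ exceptional j)
    (free : ∀ x → (∀ i → ¬ exceptional i ≈ x) → IsFreeAt x)
    where

    Exceptional : Carrier → Set ℓ
    Exceptional x = ∃ λ i → exceptional i ≈ x

    exceptional? : ∀ x → Dec (Exceptional x)
    exceptional? x = any? (λ i → exceptional i ≈? x)

    ∼-exceptional : ∀ {x y} → x ∼ y → Exceptional x → Exceptional y
    ∼-exceptional {x} {y} (g , gx≈y) (i , eᵢ≈x) =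
      let j , geᵢ≈eⱼ = exceptional-closed g i
      in  j , trans (sym geᵢ≈eⱼ) (trans (act-cong g eᵢ≈x) gx≈y)

    IsRepresentative : Fin N → Set ℓ
    IsRepresentative i = ¬ Exceptional (to i) × index (least (to i)) ≡ i

    isRepresentative? : ∀ i → Dec (IsRepresentative i)
    isRepresentative? i = ¬? (exceptional? (to i)) ×-dec (index (least (to i)) ≟ i)

    isRepresentative : Fin N → Bool
    isRepresentative i = ⌊ isRepresentative? i ⌋

    #orbits : ℕ
    #orbits = count isRepresentative

    representatives : Subset isRepresentative ↔ Fin #orbits
    representatives = Subset↔count isRepresentative

    representative : Fin #orbits → Carrier
    representative q = to (proj₁ (Inverse.from representatives q))

    representative-IsRepresentative : ∀ q → IsRepresentative (proj₁ (Inverse.from representatives q))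
    representative-IsRepresentative q =
      toWitness {a? = isRepresentative? _} (proj₂ (Inverse.from representatives q))

    representative-non-exceptional : ∀ q → ¬ Exceptional (representative q)
    representative-non-exceptional q = proj₁ (representative-IsRepresentative q)

    least-representative : ∀ q → least (representative q) ≈ representative q
    least-representative q =
      index-injective (≡.trans (proj₂ (representative-IsRepresentative q)) (≡.sym (index-to _)))

    representative-injective : ∀ {q q′} → representative q ∼ representative q′ → q ≡ q′
    representative-injective {q} {q′} r∼r′ =
      ≡.trans (≡.sym (Inverse.strictlyInverseˡ representatives q))
        (≡.trans (≡.cong (Inverse.to representatives) (Subset-≡ same-point))
          (Inverse.strictlyInverseˡ representatives q′))
      where
      same-point : proj₁ (Inverse.from representatives q) ≡ proj₁ (Inverse.from representatives q′)
      same-point = Bijection.injective enumeration (begin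
        representative q          ≈⟨ least-representative q ⟨
        least (representative q)  ≈⟨ ∼⇒least≈ r∼r′ ⟩
        least (representative q′) ≈⟨ least-representative q′ ⟩
        representative q′         ∎)

    decompose : Fin k ⊎ (Fin #orbits × H) → Carrier
    decompose (inj₁ i)       = exceptional i
    decompose (inj₂ (q , g)) = act g (representative q)

    decompose-injective : ∀ {p p′} → decompose p ≈ decompose p′ → p ≡ p′
    decompose-injective {inj₁ i}       {inj₁ j}         eq = ≡.cong inj₁ (exceptional-injective eq)
    decompose-injective {inj₁ i}       {inj₂ (q , g)}   eq =
      ⊥-elim (representative-non-exceptional q (∼-exceptional (∼-sym (g , sym eq)) (i , ≈-refl)))
    decompose-injective {inj₂ (q , g)} {inj₁ i}         eq =
      ⊥-elim (representative-non-exceptional q (∼-exceptional (∼-sym (g , eq)) (i , ≈-refl)))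
    decompose-injective {inj₂ (q , g)} {inj₂ (q′ , g′)} eq =
      ≡.cong inj₂ (×-≡,≡→≡ (q≡q′ , free r (λ i eᵢ≈r → representative-non-exceptional q (i , eᵢ≈r)) g g′
                                       (≡.subst (λ q″ → act g r ≈ act g′ (representative q″)) (≡.sym q≡q′) eq)))
      where
      r : Carrier
      r = representative q
      q≡q′ : q ≡ q′
      q≡q′ = representative-injective (∼-trans (g , eq) (∼-sym (g′ , ≈-refl)))

    decompose-surjective : ∀ x → ∃ λ p → decompose p ≈ x
    decompose-surjective x with exceptional? x
    ... | yes (i , eᵢ≈x)  = inj₁ i , eᵢ≈x
    ... | no ¬exceptional = inj₂ (q , proj₁ r∼x) , (begin
      act (proj₁ r∼x) (representative q) ≡⟨ ≡.cong (λ p → act (proj₁ r∼x) (to (proj₁ p)))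
                                              (Inverse.strictlyInverseʳ representatives _) ⟩
      act (proj₁ r∼x) (to i)             ≈⟨ proj₂ r∼x ⟩
      x                                  ∎)
      where
      i : Fin N
      i = index (least x)
      r∼x : to i ∼ x
      r∼x = ∼-trans (≈⇒∼ (to-index (least x))) (∼-sym (∼least x))
      q : Fin #orbits
      q = Inverse.to representatives (i , fromWitness {a? = isRepresentative? i}
            ( (λ exceptional-i → ¬exceptional (∼-exceptional r∼x exceptional-i))
            , index-cong (∼⇒least≈ r∼x) ))

    card : N ≡ k + #orbits * h
    card = ≡.sym (↔⇒≡ (↔-trans blocks (⤖⇒↔ indexed)))
      where
      blocks : Fin (k + #orbits * h) ↔ (Fin k ⊎ (Fin #orbits × H))
      blocks = ↔-trans +↔⊎ (⊎-cong ↔-refl (↔-trans *↔× (×-cong ↔-refl elements)))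
      indexed : (Fin k ⊎ (Fin #orbits × H)) ⤖ Fin N
      indexed = mk⤖ ( (λ eq → decompose-injective (index-injective eq))
                    , λ i → let p , p≈i = decompose-surjective (to i)
                            in  p , λ { refl → ≡.trans (index-cong p≈i) (index-to i) } )

  module Free (free : ∀ x → IsFreeAt x) where

    nowhere : Fin 0 → Carrier
    nowhere ()

    nowhere-injective : ∀ {i j} → nowhere i ≈ nowhere j → i ≡ j
    nowhere-injective {()}

    nowhere-closed : ∀ g i → ∃ λ j → act g (nowhere i) ≈ nowhere j
    nowhere-closed _ ()

    free-outside : ∀ x → (∀ i → ¬ nowhere i ≈ x) → IsFreeAt x
    free-outside x _ = free x

    open Decomposition nowhere nowhere-injective nowhere-closed free-outside public

-- Involutions and the Klein four-group

_⊕_ : Fin 2 → Fin 2 → Fin 2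
zero     ⊕ j        = j
suc zero ⊕ zero     = suc zero
suc zero ⊕ suc zero = zero

⊕-self : ∀ i → i ⊕ i ≡ zero
⊕-self zero       = refl
⊕-self (suc zero) = refl

⊕≡zero⇒≡ : ∀ i j → i ⊕ j ≡ zero → i ≡ j
⊕≡zero⇒≡ zero       zero       _ = refl
⊕≡zero⇒≡ (suc zero) (suc zero) _ = refl
⊕≡zero⇒≡ zero       (suc zero) ()
⊕≡zero⇒≡ (suc zero) zero       ()

_⊕²_ : Fin 2 × Fin 2 → Fin 2 × Fin 2 → Fin 2 × Fin 2
(i , j) ⊕² (i′ , j′) = i ⊕ i′ , j ⊕ j′

⊕²-self : ∀ p → p ⊕² p ≡ (zero , zero)
⊕²-self (i , j) = ≡.cong₂ _,_ (⊕-self i) (⊕-self j)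

module Involutions {c ℓ} (X : Setoid c ℓ) where
  open Setoid X renaming (refl to ≈-refl)
  open SetoidReasoning X

  record IsInvolution (f : Carrier → Carrier) : Set (c ⊔ ℓ) where
    field
      cong       : ∀ {x y} → x ≈ y → f x ≈ f y
      involutive : ∀ x → f (f x) ≈ x

  _^_ : (Carrier → Carrier) → Fin 2 → Carrier → Carrier
  (f ^ zero)     x = x
  (f ^ suc zero) x = f x

  ^-preserves : ∀ {p} (P : Carrier → Set p) {f} → (∀ {x} → P x → P (f x)) →
                ∀ i {x} → P x → P ((f ^ i) x)
  ^-preserves P f-preserves zero       Px = Px
  ^-preserves P f-preserves (suc zero) Px = f-preserves Px

  module _ {f} (f-involution : IsInvolution f) where
    open IsInvolution f-involution

    ^-cong : ∀ i {x y} → x ≈ y → (f ^ i) x ≈ (f ^ i) y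
    ^-cong zero       x≈y = x≈y
    ^-cong (suc zero) x≈y = cong x≈y

    ^-⊕ : ∀ i j x → (f ^ i) ((f ^ j) x) ≈ (f ^ (i ⊕ j)) x
    ^-⊕ zero       j          x = ≈-refl
    ^-⊕ (suc zero) zero       x = ≈-refl
    ^-⊕ (suc zero) (suc zero) x = involutive x

    ^-free : ∀ {x} → ¬ f x ≈ x → ∀ i j → (f ^ i) x ≈ (f ^ j) x → i ≡ j
    ^-free fx≉x zero       zero       _  = refl
    ^-free fx≉x zero       (suc zero) eq = ⊥-elim (fx≉x (sym eq))
    ^-free fx≉x (suc zero) zero       eq = ⊥-elim (fx≉x eq)
    ^-free fx≉x (suc zero) (suc zero) _  = refl

    cyclicAction : Action (Fin 2) X
    cyclicAction = record
      { e            = zero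
      ; _·_          = _⊕_
      ; inverse      = λ i → i
      ; inverseˡ     = ⊕-self
      ; act          = f ^_
      ; act-cong     = ^-cong
      ; act-identity = λ _ → ≈-refl
      ; act-compose  = ^-⊕
      }

  module _ {f g} (f-involution : IsInvolution f) (g-involution : IsInvolution g)
           (commute : ∀ x → f (g x) ≈ g (f x)) where

    ^-commute : ∀ i j x → (f ^ i) ((g ^ j) x) ≈ (g ^ j) ((f ^ i) x)
    ^-commute zero       j          x = ≈-refl
    ^-commute (suc zero) zero       x = ≈-refl
    ^-commute (suc zero) (suc zero) x = commute x

    klein : Fin 2 × Fin 2 → Carrier → Carrier
    klein (i , j) x = (f ^ i) ((g ^ j) x)

    klein-cong : ∀ p {x y} → x ≈ y → klein p x ≈ klein p y
    klein-cong (i , j) x≈y = ^-cong f-involution i (^-cong g-involution j x≈y)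

    klein-compose : ∀ p p′ x → klein p (klein p′ x) ≈ klein (p ⊕² p′) x
    klein-compose (i , j) (i′ , j′) x = begin
      (f ^ i) ((g ^ j) ((f ^ i′) ((g ^ j′) x))) ≈⟨ ^-cong f-involution i (^-commute i′ j _) ⟨
      (f ^ i) ((f ^ i′) ((g ^ j) ((g ^ j′) x))) ≈⟨ ^-⊕ f-involution i i′ _ ⟩
      (f ^ (i ⊕ i′)) ((g ^ j) ((g ^ j′) x))     ≈⟨ ^-cong f-involution (i ⊕ i′) (^-⊕ g-involution j j′ x) ⟩
      (f ^ (i ⊕ i′)) ((g ^ (j ⊕ j′)) x)         ∎

    kleinAction : Action (Fin 2 × Fin 2) X
    kleinAction = record
      { e            = zero , zero
      ; _·_          = _⊕²_
      ; inverse      = λ p → p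
      ; inverseˡ     = ⊕²-self
      ; act          = klein
      ; act-cong     = klein-cong
      ; act-identity = λ _ → ≈-refl
      ; act-compose  = klein-compose
      }

    module _ {x} (fx≉x : ¬ f x ≈ x) (gx≉x : ¬ g x ≈ x) (fgx≉x : ¬ f (g x) ≈ x) where

      klein-stabilizer : ∀ p → klein p x ≈ x → p ≡ (zero , zero)
      klein-stabilizer (zero     , zero)     _  = refl
      klein-stabilizer (zero     , suc zero) eq = ⊥-elim (gx≉x eq)
      klein-stabilizer (suc zero , zero)     eq = ⊥-elim (fx≉x eq)
      klein-stabilizer (suc zero , suc zero) eq = ⊥-elim (fgx≉x eq)

      klein-free : Action.IsFreeAt kleinAction x
      klein-free p@(i , j) p′@(i′ , j′) eq =
        ≡.cong₂ _,_ (≡.sym (⊕≡zero⇒≡ i′ i (≡.cong proj₁ p′⊕²p≡0)))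
                    (≡.sym (⊕≡zero⇒≡ j′ j (≡.cong proj₂ p′⊕²p≡0)))
        where
        p′⊕²p≡0 : p′ ⊕² p ≡ (zero , zero)
        p′⊕²p≡0 = klein-stabilizer (p′ ⊕² p) (begin
          klein (p′ ⊕² p) x     ≈⟨ klein-compose p′ p x ⟨
          klein p′ (klein p x)  ≈⟨ klein-cong p′ eq ⟩
          klein p′ (klein p′ x) ≈⟨ klein-compose p′ p′ x ⟩
          klein (p′ ⊕² p′) x    ≡⟨ ≡.cong (λ q → klein q x) (⊕²-self p′) ⟩
          x                     ∎)

-- Layouts

cast↔ : ∀ {m n} → m ≡ n → Fin m ↔ Fin n
cast↔ eq = mk↔ₛ′ (cast eq) (cast (≡.sym eq)) (cast-involutive eq (≡.sym eq)) (cast-involutive (≡.sym eq) eq)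

remQuot-injective : ∀ {m} k {I I′ : Fin (m * k)} → remQuot {m} k I ≡ remQuot k I′ → I ≡ I′
remQuot-injective {m} k {I} {I′} eq =
  ≡.trans (≡.sym (combine-remQuot {m} k I)) (≡.trans (≡.cong (uncurry combine) eq) (combine-remQuot {m} k I′))

is-just⇒≡just : ∀ {a} {A : Set a} (x : Maybe A) → T (is-just x) → ∃ λ y → x ≡ just y
is-just⇒≡just (just y) _ = y , refl

-- Cell r of row i lies in column (column i r); cells also numbers the cells of each column by Fin k.
record Layout (m n s k : ℕ) : Set where
  field
    cells            : (Fin m × Fin s) ↔ (Fin k × Fin n)
    column-injective : ∀ i → Injective _≡_ _≡_ (λ r → proj₂ (Inverse.to cells (i , r)))

  column : Fin m → Fin s → Fin n
  column i r = proj₂ (Inverse.to cells (i , r))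

  same-row-same-column : ∀ {c c′ : Fin m × Fin s} → proj₁ c ≡ proj₁ c′ →
                         column (proj₁ c) (proj₂ c) ≡ column (proj₁ c′) (proj₂ c′) → c ≡ c′
  same-row-same-column {i , r} {.i , r′} refl column≡ = ≡.cong (i ,_) (column-injective i column≡)

  slot : Fin m → Fin n → Maybe (Fin s)
  slot i j = Maybe.map proj₁ (dec⇒maybe (any? (λ r → column i r ≟ j)))

  slot-just : ∀ {i j r} → slot i j ≡ just r → column i r ≡ j
  slot-just {i} {j} with any? (λ r → column i r ≟ j)
  ... | yes (r , column≡j) = λ { refl → column≡j }
  ... | no _               = λ ()

  slot-column : ∀ i r → slot i (column i r) ≡ just r
  slot-column i r with any? (λ r′ → column i r′ ≟ column i r)
  ... | yes (r′ , column≡) = ≡.cong just (column-injective i column≡)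
  ... | no none            = ⊥-elim (none (r , refl))

  occupied : ∀ {i j r} → column i r ≡ j → T (is-just (slot i j))
  occupied {i} {r = r} refl = ≡.subst (T ∘ is-just) (≡.sym (slot-column i r)) tt

  row-occupancy : ∀ i → count (λ j → is-just (slot i j)) ≡ s
  row-occupancy i = ≡.sym (↔⇒≡ (↔-trans (⤖⇒↔ row-cells) (Subset↔count _)))
    where
    row-cells : Fin s ⤖ Subset (λ j → is-just (slot i j))
    row-cells = mk⤖ {to = λ r → column i r , occupied refl}
      ( (λ eq → column-injective i (≡.cong proj₁ eq))
      , λ (j , occupied-j) → let r , slot≡r = is-just⇒≡just (slot i j) occupied-j
                              in  r , λ { refl → Subset-≡ (slot-just slot≡r) } )

  column-occupancy : ∀ j → count (λ i → is-just (slot i j)) ≡ k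
  column-occupancy j = ≡.sym (↔⇒≡ (↔-trans (⤖⇒↔ column-cells) (Subset↔count _)))
    where
    open Inverse cells using (to; from; strictlyInverseˡ; strictlyInverseʳ)
    column-from : ∀ l → column (proj₁ (from (l , j))) (proj₂ (from (l , j))) ≡ j
    column-from l = ≡.cong proj₂ (strictlyInverseˡ (l , j))
    from-injective : ∀ l l′ → proj₁ (from (l , j)) ≡ proj₁ (from (l′ , j)) → l ≡ l′
    from-injective l l′ eq = ≡.cong proj₁ (begin
      (l , j)            ≡⟨ strictlyInverseˡ (l , j) ⟨
      to (from (l , j))  ≡⟨ ≡.cong to (same-row-same-column eq (≡.trans (column-from l) (≡.sym (column-from l′)))) ⟩
      to (from (l′ , j)) ≡⟨ strictlyInverseˡ (l′ , j) ⟩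
      (l′ , j)           ∎)
      where open ≡.≡-Reasoning
    from-to : ∀ i r → column i r ≡ j → proj₁ (from (proj₁ (to (i , r)) , j)) ≡ i
    from-to i r refl = ≡.cong proj₁ (strictlyInverseʳ (i , r))
    column-cells : Fin k ⤖ Subset (λ i → is-just (slot i j))
    column-cells = mk⤖ {to = λ l → proj₁ (from (l , j)) , occupied (column-from l)}
      ( (λ {l} {l′} eq → from-injective l l′ (≡.cong proj₁ eq))
      , λ (i , occupied-i) → let r , slot≡r = is-just⇒≡just (slot i j) occupied-i
                              in  proj₁ (to (i , r)) , λ { refl → Subset-≡ (from-to i r (slot-just slot≡r)) } )

-- Cell r of row i goes to column (s i + r) mod n, read through Fin (m * s) ≅ Fin (k * n).
cyclicLayout : ∀ {m n s k} → s ≤ n → m * s ≡ k * n → Layout m n s k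
cyclicLayout {m} {n} {s} {k} s≤n ms≡kn = record { cells = cells ; column-injective = column-injective }
  where
  cells : (Fin m × Fin s) ↔ (Fin k × Fin n)
  cells = ↔-trans (↔-sym *↔×) (↔-trans (cast↔ ms≡kn) *↔×)
  position : ∀ i r → n * toℕ (proj₁ (Inverse.to cells (i , r))) + toℕ (proj₂ (Inverse.to cells (i , r)))
                     ≡ s * toℕ i + toℕ r
  position i r = begin
    n * toℕ l + toℕ j                       ≡⟨ toℕ-combine l j ⟨
    toℕ (uncurry combine (remQuot {k} n z)) ≡⟨ ≡.cong toℕ (combine-remQuot {k} n z) ⟩
    toℕ z                                   ≡⟨ toℕ-cast ms≡kn (combine i r) ⟩
    toℕ (combine i r)                       ≡⟨ toℕ-combine i r ⟩
    s * toℕ i + toℕ r                       ∎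
    where
    open ≡.≡-Reasoning
    z : Fin (k * n)
    z = cast ms≡kn (combine i r)
    l : Fin k
    l = proj₁ (remQuot n z)
    j : Fin n
    j = proj₂ (remQuot {k} n z)
  column-injective : ∀ i → Injective _≡_ _≡_ (λ r → proj₂ (Inverse.to cells (i , r)))
  column-injective i {r} {r′} eq = toℕ-injective (residue-window
    (<-≤-trans (toℕ<n r) s≤n) (<-≤-trans (toℕ<n r′) s≤n)
    (position i r)
    (≡.trans (≡.cong (λ j → n * toℕ (proj₁ (Inverse.to cells (i , r′))) + toℕ j) eq) (position i r′)))

-- Reflections in an abelian group

module _ {ℓ₁ ℓ₂} (G : AbelianGroup ℓ₁ ℓ₂) where
  open AbelianGroup G renaming (Carrier to Γ; refl to ≈-refl)
  open import Algebra.Properties.AbelianGroup G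
    using (⁻¹-∙-comm; ⁻¹-involutive; xyx⁻¹≈y; ε⁻¹≈ε; inverseˡ-unique; inverseʳ-unique; identityʳ-unique)
  open import Algebra.Properties.CommutativeSemigroup commutativeSemigroup using (interchange)
  open import Algebra.Definitions.RawMonoid rawMonoid using () renaming (_×_ to _×ᴹ_)
  open Involutions setoid
  open SetoidReasoning setoid

  Involution : Γ → Set ℓ₂
  Involution u = ¬ u ≈ ε × u ∙ u ≈ ε

  Involution-resp : ∀ {x y} → x ≈ y → Involution x → Involution y
  Involution-resp x≈y (x≉ε , x∙x≈ε) = (λ y≈ε → x≉ε (trans x≈y y≈ε)) , trans (∙-cong (sym x≈y) (sym x≈y)) x∙x≈ε

  SquareFreeCoset : Γ → Γ → Set (ℓ₁ ⊔ ℓ₂)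
  SquareFreeCoset u σ = ∀ y → ¬ σ ≈ y ∙ y × ¬ σ ∙ u ≈ y ∙ y

  inversion : IsInvolution _⁻¹
  inversion = record { cong = ⁻¹-cong ; involutive = ⁻¹-involutive }

  reflect : Γ → Γ → Γ
  reflect p y = p ∙ y ⁻¹

  reflect-involution : ∀ p → IsInvolution (reflect p)
  reflect-involution p = record
    { cong       = λ y≈z → ∙-congˡ (⁻¹-cong y≈z)
    ; involutive = λ y → begin
        p ∙ (p ∙ y ⁻¹) ⁻¹      ≈⟨ ∙-congˡ (⁻¹-∙-comm p (y ⁻¹)) ⟨
        p ∙ (p ⁻¹ ∙ y ⁻¹ ⁻¹)   ≈⟨ assoc p (p ⁻¹) (y ⁻¹ ⁻¹) ⟨
        p ∙ p ⁻¹ ∙ y ⁻¹ ⁻¹     ≈⟨ ∙-cong (inverseʳ p) (⁻¹-involutive y) ⟩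
        ε ∙ y                  ≈⟨ identityˡ y ⟩
        y                      ∎
    }

  ∙-reflect : ∀ p y → y ∙ reflect p y ≈ p
  ∙-reflect p y = trans (sym (assoc y p (y ⁻¹))) (xyx⁻¹≈y y p)

  reflect-fixed : ∀ {p y} → reflect p y ≈ y → p ≈ y ∙ y
  reflect-fixed {p} {y} py⁻¹≈y = begin
    p               ≈⟨ identityʳ p ⟨
    p ∙ ε           ≈⟨ ∙-congˡ (inverseˡ y) ⟨
    p ∙ (y ⁻¹ ∙ y)  ≈⟨ assoc p (y ⁻¹) y ⟨
    p ∙ y ⁻¹ ∙ y    ≈⟨ ∙-congʳ py⁻¹≈y ⟩
    y ∙ y           ∎

  reflect-reflect : ∀ p q y → reflect p (reflect q y) ≈ p ∙ q ⁻¹ ∙ y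
  reflect-reflect p q y = begin
    p ∙ (q ∙ y ⁻¹) ⁻¹     ≈⟨ ∙-congˡ (⁻¹-∙-comm q (y ⁻¹)) ⟨
    p ∙ (q ⁻¹ ∙ y ⁻¹ ⁻¹)  ≈⟨ ∙-congˡ (∙-congˡ (⁻¹-involutive y)) ⟩
    p ∙ (q ⁻¹ ∙ y)        ≈⟨ assoc p (q ⁻¹) y ⟨
    p ∙ q ⁻¹ ∙ y          ∎

  reflect-preserves-involutive : ∀ {p z} → p ∙ p ≈ ε → z ∙ z ≈ ε → reflect p z ∙ reflect p z ≈ ε
  reflect-preserves-involutive {p} {z} p∙p≈ε z∙z≈ε = begin
    p ∙ z ⁻¹ ∙ (p ∙ z ⁻¹)   ≈⟨ interchange p (z ⁻¹) p (z ⁻¹) ⟩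
    p ∙ p ∙ (z ⁻¹ ∙ z ⁻¹)   ≈⟨ ∙-cong p∙p≈ε (⁻¹-∙-comm z z) ⟩
    ε ∙ (z ∙ z) ⁻¹          ≈⟨ identityˡ _ ⟩
    (z ∙ z) ⁻¹              ≈⟨ ⁻¹-cong z∙z≈ε ⟩
    ε ⁻¹                    ≈⟨ ε⁻¹≈ε ⟩
    ε                       ∎

  translate : Γ → Γ → Γ
  translate u y = y ∙ u

  translate-fixed : ∀ {u y} → translate u y ≈ y → u ≈ ε
  translate-fixed {u} {y} = identityʳ-unique y u

  module _ {u} (u∙u≈ε : u ∙ u ≈ ε) where

    u⁻¹≈u : u ⁻¹ ≈ u
    u⁻¹≈u = sym (inverseˡ-unique u u u∙u≈ε)

    translate-involution : IsInvolution (translate u)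
    translate-involution = record
      { cong       = ∙-congʳ
      ; involutive = λ y → trans (assoc y u u) (trans (∙-congˡ u∙u≈ε) (identityʳ y))
      }

    square-translate : ∀ y → translate u y ∙ translate u y ≈ y ∙ y
    square-translate y = begin
      y ∙ u ∙ (y ∙ u)  ≈⟨ interchange y u y u ⟩
      y ∙ y ∙ (u ∙ u)  ≈⟨ ∙-congˡ u∙u≈ε ⟩
      y ∙ y ∙ ε        ≈⟨ identityʳ (y ∙ y) ⟩
      y ∙ y            ∎

    square-translate^ : ∀ i y → (translate u ^ i) y ∙ (translate u ^ i) y ≈ y ∙ y
    square-translate^ i y =
      ^-preserves (λ z → z ∙ z ≈ y ∙ y) (λ z∙z≈y∙y → trans (square-translate _) z∙z≈y∙y) i ≈-refl

    -- act (i , j) y is entry (i , j) of the block [[y , σ y⁻¹] , [σ u y⁻¹ , y u]].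
    module Reflections (σ : Γ) where

      reflect-reflect-σ : ∀ y → reflect (σ ∙ u) (reflect σ y) ≈ translate u y
      reflect-reflect-σ y = begin
        reflect (σ ∙ u) (reflect σ y) ≈⟨ reflect-reflect (σ ∙ u) σ y ⟩
        σ ∙ u ∙ σ ⁻¹ ∙ y               ≈⟨ ∙-congʳ (xyx⁻¹≈y σ u) ⟩
        u ∙ y                          ≈⟨ comm u y ⟩
        y ∙ u                          ∎

      reflect-σ-reflect : ∀ y → reflect σ (reflect (σ ∙ u) y) ≈ translate u y
      reflect-σ-reflect y = begin
        reflect σ (reflect (σ ∙ u) y) ≈⟨ reflect-reflect σ (σ ∙ u) y ⟩
        σ ∙ (σ ∙ u) ⁻¹ ∙ y             ≈⟨ ∙-congʳ (∙-congˡ (⁻¹-∙-comm σ u)) ⟨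
        σ ∙ (σ ⁻¹ ∙ u ⁻¹) ∙ y          ≈⟨ ∙-congʳ (assoc σ (σ ⁻¹) (u ⁻¹)) ⟨
        σ ∙ σ ⁻¹ ∙ u ⁻¹ ∙ y            ≈⟨ ∙-congʳ (∙-cong (inverseʳ σ) u⁻¹≈u) ⟩
        ε ∙ u ∙ y                      ≈⟨ ∙-congʳ (identityˡ u) ⟩
        u ∙ y                          ≈⟨ comm u y ⟩
        y ∙ u                          ∎

      reflections-commute : ∀ y → reflect (σ ∙ u) (reflect σ y) ≈ reflect σ (reflect (σ ∙ u) y)
      reflections-commute y = trans (reflect-reflect-σ y) (sym (reflect-σ-reflect y))

      reflectionsAction : Action (Fin 2 × Fin 2) setoid
      reflectionsAction = kleinAction (reflect-involution (σ ∙ u)) (reflect-involution σ) reflections-commute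

      open Action reflectionsAction using (act; IsFreeAt)

      reflections-row : ∀ i y → act (i , zero) y ∙ act (i , suc zero) y ≈ σ
      reflections-row i y =
        trans (∙-congˡ (^-commute (reflect-involution (σ ∙ u)) (reflect-involution σ) reflections-commute
                                  i (suc zero) y))
              (∙-reflect σ (act (i , zero) y))

      reflections-column : ∀ j y → act (zero , j) y ∙ act (suc zero , j) y ≈ σ ∙ u
      reflections-column j y = ∙-reflect (σ ∙ u) (act (zero , j) y)

      reflections-free : ∀ {y} → ¬ u ≈ ε → ¬ σ ≈ y ∙ y → ¬ σ ∙ u ≈ y ∙ y → IsFreeAt y
      reflections-free {y} u≉ε σ≉y∙y σu≉y∙y =
        klein-free (reflect-involution (σ ∙ u)) (reflect-involution σ) reflections-commute
          (λ fixed → σu≉y∙y (reflect-fixed fixed))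
          (λ fixed → σ≉y∙y (reflect-fixed fixed))
          (λ fixed → u≉ε (translate-fixed (trans (sym (reflect-reflect-σ y)) fixed)))

  -- Inflating a layout by 2 × 2 blocks

  record SquareBlocks (I : Set) : Set (ℓ₁ ⊔ ℓ₂) where
    field
      entry            : I → Fin 2 × Fin 2 → Γ
      entry-injective  : ∀ {b b′ p p′} → entry b p ≈ entry b′ p′ → (b , p) ≡ (b′ , p′)
      entry-surjective : ∀ g → ∃₂ λ b p → entry b p ≈ g
      ω δ              : Γ
      row-sum          : ∀ b i → entry b (i , zero) ∙ entry b (i , suc zero) ≈ ω
      column-sum       : ∀ b j → entry b (zero , j) ∙ entry b (suc zero , j) ≈ δ

  reindex : ∀ {I J} → J ↔ I → SquareBlocks I → SquareBlocks J
  reindex {I} {J} J↔I B = record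
    { entry            = λ b → entry (to b)
    ; entry-injective  = λ eq → let to-b≡ , p≡ = ,-injective (entry-injective eq)
                                in  ×-≡,≡→≡ (to-injective to-b≡ , p≡)
    ; entry-surjective = λ g → let b , p , eq = entry-surjective g
                               in  from b , p , trans (reflexive (≡.cong (λ b → entry b p) (strictlyInverseˡ b))) eq
    ; ω                = ω
    ; δ                = δ
    ; row-sum          = λ b → row-sum (to b)
    ; column-sum       = λ b → column-sum (to b)
    }
    where
    open SquareBlocks B
    open Inverse J↔I using (to; from; strictlyInverseˡ; strictlyInverseʳ)
    to-injective : ∀ {b b′} → to b ≡ to b′ → b ≡ b′
    to-injective {b} {b′} eq =
      ≡.trans (≡.sym (strictlyInverseʳ b)) (≡.trans (≡.cong from eq) (strictlyInverseʳ b′))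

  countJust-pairs : ∀ {n} (f : Fin (n * 2) → Maybe Γ) (q : Fin n → Bool) →
                    (∀ j b → is-just (f (combine j b)) ≡ q j) → countJust f ≡ count q * 2
  countJust-pairs f q eq = ≡.trans (countJust≡count f) (count-pairs _ q eq)

  lineSum-pairs : ∀ {n} (f : Fin (n * 2) → Maybe Γ) (q : Fin n → Bool) ω →
                  (∀ j → fromMaybe ε (f (combine j zero)) ∙ fromMaybe ε (f (combine j (suc zero)))
                           ≈ (if q j then ω else ε)) →
                  lineSum G f ≈ count q ×ᴹ ω
  lineSum-pairs {zero}  f q ω pair≈ = ≈-refl
  lineSum-pairs {suc n} f q ω pair≈ = begin
    x₀ ∙ (x₁ ∙ lineSum G rest)                              ≈⟨ assoc x₀ x₁ (lineSum G rest) ⟨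
    x₀ ∙ x₁ ∙ lineSum G rest                                ≈⟨ ∙-cong (pair≈ zero) (lineSum-pairs rest q′ ω (pair≈ ∘ suc)) ⟩
    (if q zero then ω else ε) ∙ count q′ ×ᴹ ω                ≈⟨ cons (q zero) ⟩
    count q ×ᴹ ω                                            ∎
    where
    x₀ x₁ : Γ
    x₀ = fromMaybe ε (f zero)
    x₁ = fromMaybe ε (f (suc zero))
    rest : Fin (n * 2) → Maybe Γ
    rest j = f (suc (suc j))
    q′ : Fin n → Bool
    q′ j = q (suc j)
    cons : ∀ b → (if b then ω else ε) ∙ count q′ ×ᴹ ω ≈ (if b then suc (count q′) else count q′) ×ᴹ ω
    cons true  = ≈-refl
    cons false = identityˡ _

  module Inflate {m n s k c} (L : Layout m n s k) (B : SquareBlocks (Fin c × Fin m × Fin s)) where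
    open Layout L
    open SquareBlocks B

    cell : Fin c → Fin m × Fin 2 → Fin n × Fin 2 → Maybe Γ
    cell t (i , a) (j , b) = Maybe.map (λ r → entry (t , i , r) (a , b)) (slot i j)

    array : Arrays G (m * 2) (n * 2) c
    array t I J = cell t (remQuot 2 I) (remQuot 2 J)

    is-just-cell : ∀ t i a j b → is-just (cell t (i , a) (j , b)) ≡ is-just (slot i j)
    is-just-cell t i a j b with slot i j
    ... | just _  = refl
    ... | nothing = refl

    row-pair : ∀ t i a j → fromMaybe ε (cell t (i , a) (j , zero)) ∙ fromMaybe ε (cell t (i , a) (j , suc zero))
                             ≈ (if is-just (slot i j) then ω else ε)
    row-pair t i a j with slot i j
    ... | just r  = row-sum (t , i , r) a
    ... | nothing = identityˡ ε

    column-pair : ∀ t i j b → fromMaybe ε (cell t (i , zero) (j , b)) ∙ fromMaybe ε (cell t (i , suc zero) (j , b))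
                                ≈ (if is-just (slot i j) then δ else ε)
    column-pair t i j b with slot i j
    ... | just r  = column-sum (t , i , r) b
    ... | nothing = identityˡ ε

    array-row : ∀ t I j b → array t I (combine j b) ≡ cell t (remQuot 2 I) (j , b)
    array-row t I j b = ≡.cong (cell t (remQuot 2 I)) (remQuot-combine j b)

    array-column : ∀ t i a J → array t (combine i a) J ≡ cell t (i , a) (remQuot 2 J)
    array-column t i a J = ≡.cong (λ p → cell t p (remQuot 2 J)) (remQuot-combine i a)

    rowCount : ∀ t I → countJust (λ J → array t I J) ≡ s * 2
    rowCount t I = ≡.trans
      (countJust-pairs _ (λ j → is-just (slot i j))
        (λ j b → ≡.trans (≡.cong is-just (array-row t I j b)) (is-just-cell t i a j b)))
      (≡.cong (_* 2) (row-occupancy i))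
      where
      i : Fin m
      i = proj₁ (remQuot 2 I)
      a : Fin 2
      a = proj₂ (remQuot {m} 2 I)

    colCount : ∀ t J → countJust (λ I → array t I J) ≡ k * 2
    colCount t J = ≡.trans
      (countJust-pairs _ (λ i → is-just (slot i j))
        (λ i a → ≡.trans (≡.cong is-just (array-column t i a J)) (is-just-cell t i a j b)))
      (≡.cong (_* 2) (column-occupancy j))
      where
      j : Fin n
      j = proj₁ (remQuot 2 J)
      b : Fin 2
      b = proj₂ (remQuot {n} 2 J)

    rowSum : ∀ t I → lineSum G (λ J → array t I J) ≈ s ×ᴹ ω
    rowSum t I = trans
      (lineSum-pairs _ (λ j → is-just (slot i j)) ω
        (λ j → trans (∙-cong (reflexive (≡.cong (fromMaybe ε) (array-row t I j zero)))
                             (reflexive (≡.cong (fromMaybe ε) (array-row t I j (suc zero)))))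
                     (row-pair t i a j)))
      (reflexive (≡.cong (_×ᴹ ω) (row-occupancy i)))
      where
      i : Fin m
      i = proj₁ (remQuot 2 I)
      a : Fin 2
      a = proj₂ (remQuot {m} 2 I)

    colSum : ∀ t J → lineSum G (λ I → array t I J) ≈ k ×ᴹ δ
    colSum t J = trans
      (lineSum-pairs _ (λ i → is-just (slot i j)) δ
        (λ i → trans (∙-cong (reflexive (≡.cong (fromMaybe ε) (array-column t i zero J)))
                             (reflexive (≡.cong (fromMaybe ε) (array-column t i (suc zero) J))))
                     (column-pair t i j b)))
      (reflexive (≡.cong (_×ᴹ δ) (column-occupancy j)))
      where
      j : Fin n
      j = proj₁ (remQuot 2 J)
      b : Fin 2
      b = proj₂ (remQuot {n} 2 J)

    array-entry : ∀ t i r a b → array t (combine i a) (combine (column i r) b) ≡ just (entry (t , i , r) (a , b))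
    array-entry t i r a b = ≡.trans (≡.cong₂ (cell t) (remQuot-combine i a) (remQuot-combine (column i r) b))
                                    (≡.cong (Maybe.map (λ r → entry (t , i , r) (a , b))) (slot-column i r))

    array-just : ∀ t I J {x} → array t I J ≡ just x →
                 ∃ λ r → column (proj₁ (remQuot {m} 2 I)) r ≡ proj₁ (remQuot {n} 2 J)
                       × entry (t , proj₁ (remQuot {m} 2 I) , r) (proj₂ (remQuot {m} 2 I) , proj₂ (remQuot {n} 2 J)) ≡ x
    array-just t I J with slot (proj₁ (remQuot {m} 2 I)) (proj₁ (remQuot {n} 2 J)) in slot≡
    ... | just r  = λ { refl → r , slot-just slot≡ , refl }
    ... | nothing = λ ()

    entry-position-≡ : ∀ {t t′ : Fin c} {r r′ : Fin s} {p p′ : Fin m × Fin 2} {q q′ : Fin n × Fin 2} →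
              ((t , proj₁ p , r) , (proj₂ p , proj₂ q)) ≡ ((t′ , proj₁ p′ , r′) , (proj₂ p′ , proj₂ q′)) →
              column (proj₁ p) r ≡ proj₁ q → column (proj₁ p′) r′ ≡ proj₁ q′ → (t , p , q) ≡ (t′ , p′ , q′)
    entry-position-≡ refl refl refl = refl

    inflation : MRS G (m * 2) (n * 2) (s * 2) (k * 2) c
    inflation = array , record
      { appears  = λ g → let (t , i , r) , (a , b) , entry≈g = entry-surjective g
                         in  (t , combine i a , combine (column i r) b) , entry (t , i , r) (a , b)
                             , array-entry t i r a b , entry≈g
      ; unique   = unique
      ; rowCount = rowCount
      ; colCount = colCount
      ; ω        = s ×ᴹ ω
      ; δ        = k ×ᴹ δ
      ; rowSum   = rowSum
      ; colSum   = colSum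
      }
      where
      unique : ∀ g t t′ I I′ J J′ x x′ → array t I J ≡ just x → x ≈ g → array t′ I′ J′ ≡ just x′ → x′ ≈ g →
               (t , I , J) ≡ (t′ , I′ , J′)
      unique g t t′ I I′ J J′ x x′ eq x≈g eq′ x′≈g with array-just t I J eq | array-just t′ I′ J′ eq′
      ... | r , column≡ , refl | r′ , column≡′ , refl =
        ≡.cong₂ _,_ (≡.cong proj₁ same-cell)
          (≡.cong₂ _,_ (remQuot-injective 2 (≡.cong (proj₁ ∘ proj₂) same-cell))
                       (remQuot-injective 2 (≡.cong (proj₂ ∘ proj₂) same-cell)))
        where
        same-cell : (t , remQuot 2 I , remQuot 2 J) ≡ (t′ , remQuot 2 I′ , remQuot 2 J′)
        same-cell = entry-position-≡ (entry-injective (trans x≈g (sym x′≈g))) column≡ column≡′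

  -- Finite abelian groups of order divisible by 4

  module FiniteAbelianGroup {N} (order : HasOrder G N) where
    open FiniteSetoid order

    nonZero-orbits : ∀ {R h} → N ≡ R * h → NonZero R
    nonZero-orbits {R} N≡Rh = m*n≢0⇒m≢0 R ⦃ ≡.subst NonZero N≡Rh (nonZeroIndex (index ε)) ⦄

    involution? : ∀ u → Dec (Involution u)
    involution? u = ¬? (u ≈? ε) ×-dec (u ∙ u ≈? ε)

    -- Otherwise inversion acts freely off ε, and N = 1 + #orbits * 2.
    involution-exists : 2 ∣ N → ∃ Involution
    involution-exists 2∣N with search Involution Involution-resp involution?
    ... | yes found = found
    ... | no no-involution =
      contradiction (≡.subst (2 ∣_) O.card 2∣N) (∤m+k*n O.#orbits (s≤s z≤n) (s≤s (s≤s z≤n)))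
      where
      free : ∀ x → (∀ i → ¬ ε ≈ x) → Action.IsFreeAt (cyclicAction inversion) x
      free x x≉ε = ^-free inversion λ x⁻¹≈x →
        no-involution (x , (λ x≈ε → x≉ε zero (sym x≈ε)) , trans (∙-congˡ (sym x⁻¹≈x)) (inverseʳ x))
      only-ε : Fin 1 → Γ
      only-ε _ = ε
      only-ε-injective : ∀ {i j} → only-ε i ≈ only-ε j → i ≡ j
      only-ε-injective {zero} {zero} _ = refl
      only-ε-closed : ∀ g i → ∃ λ j → (_⁻¹ ^ g) (only-ε i) ≈ only-ε j
      only-ε-closed g _ = zero , ^-preserves (_≈ ε) (λ x≈ε → trans (⁻¹-cong x≈ε) ε⁻¹≈ε) g ≈-refl
      module O = Orbits.Decomposition order ↔-refl (cyclicAction inversion) only-ε only-ε-injective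
                   only-ε-closed free

    module _ {u} (u≉ε : ¬ u ≈ ε) (u∙u≈ε : u ∙ u ≈ ε) where

      translation-by-u : IsInvolution (translate u)
      translation-by-u = translate-involution u∙u≈ε

      squarefree-coset-of-cover : ∀ {A : Set} {m} → Fin m ↔ A → m < N → (f : A → Γ) →
                                  (∀ y → ∃ λ a → f a ≈ y ∙ y) → (∀ y → ∃ λ a → f a ≈ y ∙ y ∙ u) →
                                  ∃ (SquareFreeCoset u)
      squarefree-coset-of-cover A-elements m<N f squares translates =
        σ , λ y → (λ σ≈y∙y → let a , fa≈y∙y = squares y in σ-missed a (trans fa≈y∙y (sym σ≈y∙y)))
                , (λ σu≈y∙y → let a , fa≈y∙yu = translates y in
                                σ-missed a (trans fa≈y∙yu (sym (trans (sym (IsInvolution.involutive translation-by-u σ))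
                                                                      (∙-congʳ σu≈y∙y)))))
        where
        σ : Γ
        σ = proj₁ (missed-point A-elements f m<N)
        σ-missed : ∀ a → ¬ f a ≈ σ
        σ-missed = proj₂ (missed-point A-elements f m<N)

      -- Squares are constant on the orbits of translation by u, so there are at most N / 2 of them;
      -- and σ u is a square only if σ is, u being one.
      squarefree-coset-of-root : ∀ {y₀} → y₀ ∙ y₀ ≈ u → ∃ (SquareFreeCoset u)
      squarefree-coset-of-root {y₀} y₀∙y₀≈u = squarefree-coset-of-cover ↔-refl R<N square covers translates
        where
        module O = Orbits.Free order ↔-refl (cyclicAction translation-by-u)
                     (λ x → ^-free translation-by-u (λ xu≈x → u≉ε (translate-fixed xu≈x)))
        square : Fin O.#orbits → Γ
        square q = O.representative q ∙ O.representative q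
        R<N : O.#orbits < N
        R<N = ≡.subst (O.#orbits <_) (≡.sym O.card) (m<m*n O.#orbits 2 ⦃ nonZero-orbits O.card ⦄ (s≤s (s≤s z≤n)))
        covers : ∀ y → ∃ λ q → square q ≈ y ∙ y
        covers y = square-of-decomposition (O.decompose-surjective y)
          where
          square-of-decomposition : ∃ (λ p → O.decompose p ≈ y) → ∃ λ q → square q ≈ y ∙ y
          square-of-decomposition (inj₂ (q , g) , gr≈y) =
            q , trans (sym (square-translate^ u∙u≈ε g _)) (∙-cong gr≈y gr≈y)
        translates : ∀ y → ∃ λ q → square q ≈ y ∙ y ∙ u
        translates y = let q , eq = covers (y ∙ y₀) in q , (begin
          square q              ≈⟨ eq ⟩
          y ∙ y₀ ∙ (y ∙ y₀)     ≈⟨ interchange y y₀ y y₀ ⟩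
          y ∙ y ∙ (y₀ ∙ y₀)     ≈⟨ ∙-congˡ y₀∙y₀≈u ⟩
          y ∙ y ∙ u             ∎)

      -- Squares are constant on the orbits of the translations by t and u, so the squares and their
      -- u-translates number at most N / 2.
      squarefree-coset-of-involution : ∀ {t} → Involution t → ¬ t ≈ u → ∃ (SquareFreeCoset u)
      squarefree-coset-of-involution {t} (t≉ε , t∙t≈ε) t≉u =
        squarefree-coset-of-cover *↔× R*2<N square covers translates
        where
        translation-by-t : IsInvolution (translate t)
        translation-by-t = translate-involution t∙t≈ε
        translations-commute : ∀ y → translate t (translate u y) ≈ translate u (translate t y)
        translations-commute y = begin
          y ∙ u ∙ t    ≈⟨ assoc y u t ⟩
          y ∙ (u ∙ t)  ≈⟨ ∙-congˡ (comm u t) ⟩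
          y ∙ (t ∙ u)  ≈⟨ assoc y t u ⟨
          y ∙ t ∙ u    ∎
        module O = Orbits.Free order *↔× (kleinAction translation-by-t translation-by-u translations-commute)
                     (λ x → klein-free translation-by-t translation-by-u translations-commute
                        (λ xt≈x → t≉ε (translate-fixed xt≈x))
                        (λ xu≈x → u≉ε (translate-fixed xu≈x))
                        (λ xut≈x → t≉u (trans (inverseʳ-unique u t (translate-fixed (trans (sym (assoc x u t)) xut≈x)))
                                              (u⁻¹≈u u∙u≈ε))))
        square : Fin O.#orbits × Fin 2 → Γ
        square (q , b) = (translate u ^ b) (O.representative q ∙ O.representative q)
        R*2<N : O.#orbits * 2 < N
        R*2<N = ≡.subst (O.#orbits * 2 <_) (≡.sym O.card)
                  (*-monoʳ-< O.#orbits ⦃ nonZero-orbits O.card ⦄ (s≤s (s≤s (s≤s z≤n))))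
        orbit-square : ∀ y → ∃ λ q → O.representative q ∙ O.representative q ≈ y ∙ y
        orbit-square y = square-of-decomposition (O.decompose-surjective y)
          where
          square-of-decomposition : ∃ (λ p → O.decompose p ≈ y) →
                                    ∃ λ q → O.representative q ∙ O.representative q ≈ y ∙ y
          square-of-decomposition (inj₂ (q , (i , j)) , gr≈y) =
            q , trans (sym (trans (square-translate^ t∙t≈ε i _) (square-translate^ u∙u≈ε j _)))
                      (∙-cong gr≈y gr≈y)
        covers : ∀ y → ∃ λ a → square a ≈ y ∙ y
        covers y = let q , eq = orbit-square y in (q , zero) , eq
        translates : ∀ y → ∃ λ a → square a ≈ y ∙ y ∙ u
        translates y = let q , eq = orbit-square y in (q , suc zero) , ∙-congʳ eq

      -- Inversion and y ↦ u y⁻¹ generate a Klein four-group acting freely off {ε, u}, so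
      -- N = 2 + #orbits * 4.
      unique-involution-is-square : 4 ∣ N → (∀ t → Involution t → t ≈ u) → ¬ (∀ y → ¬ y ∙ y ≈ u)
      unique-involution-is-square 4∣N unique no-root =
        contradiction (≡.subst (4 ∣_) O.card 4∣N) (∤m+k*n O.#orbits (s≤s z≤n) (s≤s (s≤s (s≤s z≤n))))
        where
        open Reflections u∙u≈ε ε
        exceptional : Fin 2 → Γ
        exceptional zero       = ε
        exceptional (suc zero) = u
        exceptional-injective : ∀ {i j} → exceptional i ≈ exceptional j → i ≡ j
        exceptional-injective {zero}     {zero}     _   = refl
        exceptional-injective {zero}     {suc zero} ε≈u = ⊥-elim (u≉ε (sym ε≈u))
        exceptional-injective {suc zero} {zero}     u≈ε = ⊥-elim (u≉ε u≈ε)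
        exceptional-injective {suc zero} {suc zero} _   = refl
        exceptional-square : ∀ i → exceptional i ∙ exceptional i ≈ ε
        exceptional-square zero       = identityˡ ε
        exceptional-square (suc zero) = u∙u≈ε
        square-root-of-ε : ∀ {z} → z ∙ z ≈ ε → ∃ λ i → z ≈ exceptional i
        square-root-of-ε {z} z∙z≈ε with z ≈? ε
        ... | yes z≈ε = zero , z≈ε
        ... | no z≉ε  = suc zero , unique z (z≉ε , z∙z≈ε)
        closed : ∀ g i → ∃ λ j → Action.act reflectionsAction g (exceptional i) ≈ exceptional j
        closed (i , j) k = square-root-of-ε
          (^-preserves P (reflect-preserves-involutive (trans (∙-cong (identityˡ u) (identityˡ u)) u∙u≈ε)) i
            (^-preserves P (reflect-preserves-involutive (identityˡ ε)) j (exceptional-square k)))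
          where
          P : Γ → Set ℓ₂
          P z = z ∙ z ≈ ε
        free : ∀ y → (∀ i → ¬ exceptional i ≈ y) → Action.IsFreeAt reflectionsAction y
        free y not-exceptional = reflections-free u≉ε
          (λ ε≈y∙y → let i , y≈eᵢ = square-root-of-ε (sym ε≈y∙y) in not-exceptional i (sym y≈eᵢ))
          (λ εu≈y∙y → no-root y (sym (trans (sym (identityˡ u)) εu≈y∙y)))
        module O = Orbits.Decomposition order *↔× reflectionsAction exceptional exceptional-injective closed free

      squarefree-coset : 4 ∣ N → ∃ (SquareFreeCoset u)
      squarefree-coset 4∣N
        with search (λ t → Involution t × ¬ t ≈ u)
                    (λ x≈y (x-involution , x≉u) → Involution-resp x≈y x-involution , λ y≈u → x≉u (trans x≈y y≈u))
                    (λ t → involution? t ×-dec ¬? (t ≈? u))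
      ... | yes (t , t-involution , t≉u) = squarefree-coset-of-involution t-involution t≉u
      ... | no no-other
        with search (λ y → y ∙ y ≈ u) (λ x≈y x∙x≈u → trans (∙-cong (sym x≈y) (sym x≈y)) x∙x≈u) (λ y → y ∙ y ≈? u)
      ...   | yes (y₀ , y₀∙y₀≈u) = squarefree-coset-of-root y₀∙y₀≈u
      ...   | no no-root = ⊥-elim (unique-involution-is-square 4∣N unique (λ y y∙y≈u → no-root (y , y∙y≈u)))
        where
        unique : ∀ t → Involution t → t ≈ u
        unique t t-involution with t ≈? u
        ... | yes t≈u = t≈u
        ... | no t≉u  = ⊥-elim (no-other (t , t-involution , t≉u))

    square-blocks-of-coset : ∀ {u σ} → Involution u → SquareFreeCoset u σ →
                             ∃ λ R → N ≡ R * 4 × SquareBlocks (Fin R)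
    square-blocks-of-coset {u} {σ} (u≉ε , u∙u≈ε) σ-squarefree = O.#orbits , O.card , record
      { entry            = λ q p → act p (O.representative q)
      ; entry-injective  = λ eq → inj₂-injective (O.decompose-injective eq)
      ; entry-surjective = λ g → orbit-point (O.decompose-surjective g)
      ; ω                = σ
      ; δ                = σ ∙ u
      ; row-sum          = λ q i → reflections-row i (O.representative q)
      ; column-sum       = λ q j → reflections-column j (O.representative q)
      }
      where
      open Reflections u∙u≈ε σ
      open Action reflectionsAction using (act)
      module O = Orbits.Free order *↔× reflectionsAction
                   (λ y → reflections-free u≉ε (proj₁ (σ-squarefree y)) (proj₂ (σ-squarefree y)))
      orbit-point : ∀ {g} → ∃ (λ p → O.decompose p ≈ g) → ∃₂ λ q p → act p (O.representative q) ≈ g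
      orbit-point (inj₂ (q , p) , eq) = q , p , eq

    square-blocks : 4 ∣ N → ∃ λ R → N ≡ R * 4 × SquareBlocks (Fin R)
    square-blocks 4∣N =
      let u , u≉ε , u∙u≈ε = involution-exists (∣-trans (divides 2 refl) 4∣N)
          σ , σ-squarefree = squarefree-coset u≉ε u∙u≈ε 4∣N
      in  square-blocks-of-coset (u≉ε , u∙u≈ε) σ-squarefree

halved-balance : ∀ m s n k → m * 2 * (s * 2) ≡ n * 2 * (k * 2) → m * s ≡ k * n
halved-balance m s n k eq = *-cancelʳ-≡ (m * s) (k * n) 4 (≡.trans (lhs m s) (≡.trans eq (rhs n k)))
  where
  lhs : ∀ m s → m * s * 4 ≡ m * 2 * (s * 2)
  lhs = solve-∀
  rhs : ∀ n k → n * 2 * (k * 2) ≡ k * n * 4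
  rhs = solve-∀

4∣order : ∀ n k c → 4 ∣ n * 2 * (k * 2) * c
4∣order n k c = divides (n * k * c) (eq n k c)
  where
  eq : ∀ n k c → n * 2 * (k * 2) * c ≡ n * k * c * 4
  eq = solve-∀

block-count : ∀ m s n k c R → m * s ≡ k * n → n * 2 * (k * 2) * c ≡ R * 4 → c * (m * s) ≡ R
block-count m s n k c R ms≡kn N≡R*4 =
  *-cancelʳ-≡ (c * (m * s)) R 4 (≡.trans (≡.cong (λ x → c * x * 4) ms≡kn) (≡.trans (eq n k c) N≡R*4))
  where
  eq : ∀ n k c → c * (k * n) * 4 ≡ n * 2 * (k * 2) * c
  eq = solve-∀

proposition5p10 : ∀ {a ℓ : Level} (m n s k c : ℕ) →
    2 ∣ m → 2 ∣ n → 2 ∣ s → 2 ∣ k →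
    2 ≤ s → s ≤ n → 2 ≤ k → k ≤ m → m * s ≡ n * k → 1 ≤ c →
    (G : AbelianGroup a ℓ) → HasOrder G (n * k * c) →
    MRS G m n s k c
proposition5p10 .(m * 2) .(n * 2) .(s * 2) .(k * 2) c
                (divides m refl) (divides n refl) (divides s refl) (divides k refl)
                _ s≤n _ _ ms≡nk _ G order =
  let R , N≡R*4 , blocks = FiniteAbelianGroup.square-blocks G order (4∣order n k c)
      ms≡kn : m * s ≡ k * n
      ms≡kn = halved-balance m s n k ms≡nk
      block-index : (Fin c × Fin m × Fin s) ↔ Fin R
      block-index = ↔-trans (×-cong ↔-refl (↔-sym *↔×))
                      (↔-trans (↔-sym *↔×) (cast↔ (block-count m s n k c R ms≡kn N≡R*4)))
  in  Inflate.inflation G (cyclicLayout {k = k} (*-cancelʳ-≤ s n 2 s≤n) ms≡kn) (reindex G block-index blocks)
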